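{- Let $G$ be a $k$-connected graph and let $\mathfrak S\subset\mathfrak R_k(G)$ be a set of pairwise independent cutsets. Then: (1) $\mathfrak S\subset\mathfrak R_k(G^{\mathfrak S})$, and $\mathrm{Part}(G;\mathfrak S)=\mathrm{Part}(G^{\mathfrak S};\mathfrak S)$. (2) Let $\mathfrak T\subset\mathfrak S$, let $B\in\mathrm{Part}(G;\mathfrak T)$, and let $R$ be a cutset of the graph $G^{\mathfrak S}(B)$. Then $R$ is a cutset of $G$. In particular, the graph $G^{\mathfrak S}(B)$ is $k$-connected.
   Context: All graphs are finite, undirected, without loops or multiple edges. $G(U)$ denotes the subgraph induced on $U\subset V(G)$; $G-R$ is obtained by deleting the vertices of $R$. A connected component means the vertex set of a maximal connected subgraph. A set $R\subset V(G)$ is a cutset if $G-R$ is disconnected; $\mathfrak R(G)$ denotes the set of all cutsets and $\mathfrak R_k(G)$ those with exactly $k$ vertices. For $X,Y\subset V(G)$ with $X\not\subset R$, $Y\not\subset R$, $R$ separates $X$ from $Y$ if no vertex of $X\setminus R$ and no vertex of $Y\setminus R$ lie in a common connected component of $G-R$. $R$ splits $X$ if $X\setminus R$ is not contained in one connected component of $G-R$. $G$ is $k$-connected if $v(G)>k$ and $G$ has no cutset with at most $k-1$ vertices. Cutsets $S,T\in\mathfrak R_k(G)$ are independent if neither splits the other. For $\mathfrak S\subset\mathfrak R(G)$, a set $A\subset V(G)$ is a part of the $\mathfrak S$-decomposition if no cutset of $\mathfrak S$ splits $A$, but every vertex $b\in V(G)\setminus A$ is separated from $A$ by some cutset of $\mathfrak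 S$; $\mathrm{Part}(G;\mathfrak S)$ is the set of all such parts. $G^{\mathfrak S}$ is the graph on $V(G)$ obtained from $G$ by adding, for each $S\in\mathfrak S$, all edges joining pairs of vertices of $S$. -}

module Defs where

open import Level using (0ℓ)
open import Data.Nat using (ℕ; _≤_; _<_)
open import Data.Fin using (Fin)
open import Data.Fin.Subset using (Subset; _∈_; _∉_; _⊆_; _⊈_; ∁; _─_; ⁅_⁆; ∣_∣; ⊤)
open import Data.Product using (Σ; ∃; _×_; _,_)
open import Data.Sum using (_⊎_)
open import Relation.Nullary using (¬_)
open import Relation.Binary.PropositionalEquality using (_≡_; _≢_)
open import Relation.Unary using (Pred)

record Graph (n : ℕ) : Set₁ where
  field
    Adj   : Fin n → Fin n → Set
    sym   : ∀ {u v} → Adj u v → Adj v u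
    irrefl : ∀ {u} → ¬ Adj u u
open Graph public

Family : ℕ → Set₁
Family n = Pred (Subset n) 0ℓ

module _ {n : ℕ} where

  data Reach (G : Graph n) (W : Subset n) : Fin n → Fin n → Set where
    here : ∀ {x} → x ∈ W → Reach G W x x
    step : ∀ {x y z} → Reach G W x y → Adj G y z → z ∈ W → Reach G W x z

  CutsetIn : Graph n → Subset n → Subset n → Set
  CutsetIn G B R = R ⊆ B × ∃ λ x → ∃ λ y →
    x ∈ (B ─ R) × y ∈ (B ─ R) × ¬ Reach G (B ─ R) x y

  Cutset : Graph n → Subset n → Set
  Cutset G R = CutsetIn G ⊤ R

  Cutsetₖ : Graph n → ℕ → Subset n → Set
  Cutsetₖ G k R = Cutset G R × ∣ R ∣ ≡ k

  KConnectedIn : Graph n → ℕ → Subset n → Set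
  KConnectedIn G k B = k < ∣ B ∣ × (∀ R → CutsetIn G B R → k ≤ ∣ R ∣)

  KConnected : Graph n → ℕ → Set
  KConnected G k = KConnectedIn G k ⊤

  Separates : Graph n → Subset n → Subset n → Subset n → Set
  Separates G R X Y = X ⊈ R × Y ⊈ R ×
    (∀ x y → x ∈ X → x ∉ R → y ∈ Y → y ∉ R → ¬ Reach G (∁ R) x y)

  Splits : Graph n → Subset n → Subset n → Set
  Splits G R X = ∃ λ x → ∃ λ y →
    x ∈ X × x ∉ R × y ∈ X × y ∉ R × ¬ Reach G (∁ R) x y

  Independent : Graph n → Subset n → Subset n → Set
  Independent G S T = ¬ Splits G S T × ¬ Splits G T S

  IsPart : Graph n → Family n → Subset n → Set
  IsPart G 𝔖 A = (∀ S → 𝔖 S → ¬ Splits G S A) ×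
    (∀ b → b ∉ A → ∃ λ S → 𝔖 S × Separates G S ⁅ b ⁆ A)

  saturate : Graph n → Family n → Graph n
  saturate G 𝔖 = record
    { Adj = λ u v → Adj G u v ⊎ (u ≢ v × ∃ λ S → 𝔖 S × u ∈ S × v ∈ S)
    ; sym = sy
    ; irrefl = ir
    }
    where
    open import Data.Sum using (inj₁; inj₂)
    open import Relation.Binary.PropositionalEquality using (refl)
    import Relation.Binary.PropositionalEquality as Eq
    sy : ∀ {u v} → Adj G u v ⊎ (u ≢ v × ∃ λ S → 𝔖 S × u ∈ S × v ∈ S)
                 → Adj G v u ⊎ (v ≢ u × ∃ λ S → 𝔖 S × v ∈ S × u ∈ S)
    sy (inj₁ a) = inj₁ (Graph.sym G a)
    sy (inj₂ (ne , S , s , u∈ , v∈)) = inj₂ ((λ e → ne (Eq.sym e)) , S , s , v∈ , u∈)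
    ir : ∀ {u} → ¬ (Adj G u u ⊎ (u ≢ u × ∃ λ S → 𝔖 S × u ∈ S × u ∈ S))
    ir (inj₁ a) = Graph.irrefl G a
    ir (inj₂ (ne , _)) = ne refl

module Submission where

-- If S splits no member of 𝔖, every added edge outside S joins two
-- vertices of some T ∈ 𝔖 which are already connected in G - S; so S separates
-- exactly the same pairs in G and in G^𝔖.  Cutsets, splitting, separation and
-- parts only depend on these separated pairs.
--
-- A walk of G - R starting in a 𝔗-part B is traced by a walk of
-- G^𝔖(B ─ R): every excursion out of B runs beyond some T ∈ 𝔗 and returns to
-- B through T, where a saturated edge shortcuts it.  So cutsets of G^𝔖(B) are
-- cutsets of G, of size ≥ k.  Finally ∣B∣ > k: otherwise we can pick T ∈ 𝔗 with
-- B ⊈ T and a vertex t ∈ T ∖ B, which lies beyond some T′ ∈ 𝔗; minimality of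
-- the k-cutset T shows that everything beyond T lies beyond T′ as well, so
-- the set of vertices lying beyond a single member of 𝔗 could be enlarged
-- forever inside the finite vertex set.

open import Defs
open import Data.Nat using (ℕ; zero; suc; _+_; _≤_; _<_)
open import Data.Nat.Properties using (≤⇒≯; ≰⇒>; <-≤-trans; n<1+n; m≤m+n; +-suc; +-monoʳ-≤)
open import Data.Fin using (Fin; _≟_)
open import Data.Fin.Properties using (any?)
open import Data.Fin.Subset
  using (Subset; _∈_; _∉_; _⊈_; _⊂_; ∁; _─_; _-_; ⁅_⁆; ∣_∣; ⊤; _∪_; inside; outside)
  renaming (⊥ to ∅)
open import Data.Fin.Subset.Properties
  using ( _∈?_; ⊆⊤; ∉⊥; x∈⁅x⁆; x∈⁅y⁆⇒x≡y; ∣p∣≤n; p⊆q⇒∣p∣≤∣q∣; p⊂q⇒∣p∣<∣q∣; x∈p⇒∣p-x∣<∣p∣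
        ; x∈∁p⇒x∉p; x∉p⇒x∈∁p; x∈p∧x∉q⇒x∈p─q; p─q⊆p; x∈p∧x≢y⇒x∈p-y
        ; p⊆p∪q; x∈p∪q⁺; x∈p∪q⁻ )
open import Data.Vec.Base using ([]; _∷_; here; there)
open import Data.Product using (∃; ∃₂; _×_; _,_; proj₁; proj₂)
open import Data.Sum using (_⊎_; inj₁; inj₂)
open import Data.Empty using (⊥; ⊥-elim)
open import Relation.Nullary using (¬_; yes; no; ¬?)
open import Relation.Nullary.Decidable using (_×-dec_; decidable-stable)
open import Relation.Binary.PropositionalEquality using (_≡_; _≢_; refl; cong; subst)
import Relation.Binary.PropositionalEquality as ≡
open import Function.Bundles using (_⇔_; mk⇔; Equivalence)
import Function.Properties.Equivalence as ⇔

x∈p─q⇒x∉q : ∀ {n} (p q : Subset n) {x : Fin n} → x ∈ p ─ q → x ∉ q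
x∈p─q⇒x∉q (_ ∷ p) (inside  ∷ q) {Fin.zero}  ()
x∈p─q⇒x∉q (_ ∷ p) (outside ∷ q) {Fin.zero}  _         ()
x∈p─q⇒x∉q (_ ∷ p) (inside  ∷ q) {Fin.suc x} (there m) (there m′) = x∈p─q⇒x∉q p q m m′
x∈p─q⇒x∉q (_ ∷ p) (outside ∷ q) {Fin.suc x} (there m) (there m′) = x∈p─q⇒x∉q p q m m′

-- Removing a set from the full vertex set leaves its complement; this turns
-- the definition of cutsets (via G(⊤ ─ R)) into the familiar G - R = G(∁ R).
⊤─p≡∁p : ∀ {n} (p : Subset n) → ⊤ ─ p ≡ ∁ p
⊤─p≡∁p []            = refl
⊤─p≡∁p (inside  ∷ p) = cong (outside ∷_) (⊤─p≡∁p p)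
⊤─p≡∁p (outside ∷ p) = cong (inside ∷_) (⊤─p≡∁p p)

⊈⇒witness : ∀ {n} {p q : Subset n} → p ⊈ q → ∃ λ x → x ∈ p × x ∉ q
⊈⇒witness {p = p} {q} p⊈q with any? (λ x → x ∈? p ×-dec ¬? (x ∈? q))
... | yes witness = witness
... | no ¬witness = ⊥-elim (p⊈q λ {x} x∈p →
        decidable-stable (x ∈? q) λ x∉q → ¬witness (x , x∈p , x∉q))

⊈-of-smaller : ∀ {n} {p q : Subset n} → ∣ p ∣ ≤ ∣ q ∣ → p ⊈ q →
  ∃ λ x → x ∈ q × x ∉ p
⊈-of-smaller {p = p} {q} ∣p∣≤∣q∣ p⊈q = ⊈⇒witness q⊈p
  where
  q⊈p : q ⊈ p
  q⊈p q⊆p with ⊈⇒witness p⊈q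
  ... | x , x∈p , x∉q = ≤⇒≯ ∣p∣≤∣q∣ (p⊂q⇒∣p∣<∣q∣ (q⊆p , x , x∈p , x∉q))

no-endless-growth : ∀ {n} (P : Subset n → Set) →
  (∀ {L} → P L → ∃ λ L′ → L ⊂ L′ × P L′) → ∀ L → ¬ P L
no-endless-growth {n} P grow L = bounded (suc n) (<-≤-trans (n<1+n n) (m≤m+n (suc n) ∣ L ∣))
  where
  -- after m further growth steps a set would have more than n elements
  bounded : ∀ m {L} → n < m + ∣ L ∣ → ¬ P L
  bounded zero    {L} n<∣L∣ _ = ≤⇒≯ (∣p∣≤n L) n<∣L∣
  bounded (suc m) {L} n<m+∣L∣ pL with grow pL
  ... | L′ , L⊂L′ , pL′ = bounded m (<-≤-trans n<m+∣L∣ ∣L∣<∣L′∣) pL′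
    where
    ∣L∣<∣L′∣ : suc m + ∣ L ∣ ≤ m + ∣ L′ ∣
    ∣L∣<∣L′∣ = subst (_≤ m + ∣ L′ ∣) (+-suc m ∣ L ∣) (+-monoʳ-≤ m (p⊂q⇒∣p∣<∣q∣ L⊂L′))

-- Walks, cutsets and the region beyond a cutset

module _ {n : ℕ} (G : Graph n) where

  reach-ends : ∀ {W x y} → Reach G W x y → x ∈ W × y ∈ W
  reach-ends (here x∈W)     = x∈W , x∈W
  reach-ends (step r _ z∈W) = proj₁ (reach-ends r) , z∈W

  reach-trans : ∀ {W x y z} → Reach G W x y → Reach G W y z → Reach G W x z
  reach-trans r (here _)       = r
  reach-trans r (step s a z∈W) = step (reach-trans r s) a z∈W

  edge : ∀ {W x y} → x ∈ W → Adj G x y → y ∈ W → Reach G W x y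
  edge x∈W a y∈W = step (here x∈W) a y∈W

  reach-sym : ∀ {W x y} → Reach G W x y → Reach G W y x
  reach-sym (here x∈W)     = here x∈W
  reach-sym (step r a z∈W) =
    reach-trans (edge z∈W (sym G a) (proj₂ (reach-ends r))) (reach-sym r)

  first-hit : ∀ {W X x y} → Reach G W x y →
    Reach G (∁ X) x y ⊎ ∃ λ w → w ∈ X × Reach G W x w
  first-hit {X = X} {x = x} (here x∈W) with x ∈? X
  ... | yes x∈X = inj₂ (x , x∈X , here x∈W)
  ... | no x∉X  = inj₁ (here (x∉p⇒x∈∁p x∉X))
  first-hit {X = X} (step {z = z} r a z∈W) with first-hit r
  ... | inj₂ (w , w∈X , r′) = inj₂ (w , w∈X , r′)
  ... | inj₁ r′ with z ∈? X
  ...   | yes z∈X = inj₂ (z , z∈X , step r a z∈W)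
  ...   | no z∉X  = inj₁ (step r′ a (x∉p⇒x∈∁p z∉X))

  cutset⁺ : ∀ {R x y} → x ∉ R → y ∉ R → ¬ Reach G (∁ R) x y → Cutset G R
  cutset⁺ {R} {x} {y} x∉R y∉R ¬r =
    ⊆⊤ , x , y , to-⊤─ (x∉p⇒x∈∁p x∉R) , to-⊤─ (x∉p⇒x∈∁p y∉R) ,
    subst (λ W → ¬ Reach G W x y) (≡.sym (⊤─p≡∁p R)) ¬r
    where
    to-⊤─ : ∀ {v} → v ∈ ∁ R → v ∈ ⊤ ─ R
    to-⊤─ {v} = subst (v ∈_) (≡.sym (⊤─p≡∁p R))

  cutset⁻ : ∀ {R} → Cutset G R → ∃₂ λ x y → x ∉ R × y ∉ R × ¬ Reach G (∁ R) x y
  cutset⁻ {R} (_ , x , y , x∈ , y∈ , ¬r) =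
    x , y , x∈∁p⇒x∉p (subst (x ∈_) (⊤─p≡∁p R) x∈) ,
    x∈∁p⇒x∉p (subst (y ∈_) (⊤─p≡∁p R) y∈) ,
    subst (λ W → ¬ Reach G W x y) (⊤─p≡∁p R) ¬r

  Beyond : Subset n → Subset n → Fin n → Set
  Beyond T B v = v ∉ T × (∀ b → b ∈ B → b ∉ T → ¬ Reach G (∁ T) v b)

  beyond-closed : ∀ {T B v z} → Beyond T B v → Reach G (∁ T) v z → Beyond T B z
  beyond-closed (_ , v-beyond) r =
    x∈∁p⇒x∉p (proj₂ (reach-ends r)) ,
    λ b b∈B b∉T s → v-beyond b b∈B b∉T (reach-trans r s)

  beyond⇒∉ : ∀ {T B v} → Beyond T B v → v ∉ B
  beyond⇒∉ (v∉T , v-beyond) v∈B = v-beyond _ v∈B v∉T (here (x∉p⇒x∈∁p v∉T))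

  part-exterior : ∀ {𝔗 B z} → IsPart G 𝔗 B → z ∉ B →
    ∃ λ T → 𝔗 T × B ⊈ T × Beyond T B z
  part-exterior {z = z} (_ , separated) z∉B with separated z z∉B
  ... | T , τ , (⁅z⁆⊈T , B⊈T , sep) =
    T , τ , B⊈T , z∉T , λ b b∈B b∉T → sep z b (x∈⁅x⁆ z) z∉T b∈B b∉T
    where
    z∉T : z ∉ T
    z∉T z∈T = ⁅z⁆⊈T λ {w} w∈⁅z⁆ → subst (_∈ T) (≡.sym (x∈⁅y⁆⇒x≡y z w∈⁅z⁆)) z∈T

-- Splitting, separation, cutsets and parts depend on a graph only through the
-- pairs of vertices that each cutset separates.

module _ {n : ℕ} {G H : Graph n} where

  splits-transfer : ∀ {S A} → (∀ {x y} → ¬ Reach G (∁ S) x y → ¬ Reach H (∁ S) x y) →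
    Splits G S A → Splits H S A
  splits-transfer f (x , y , x∈A , x∉S , y∈A , y∉S , ¬r) = x , y , x∈A , x∉S , y∈A , y∉S , f ¬r

  separates-transfer : ∀ {S X Y} → (∀ {x y} → ¬ Reach G (∁ S) x y → ¬ Reach H (∁ S) x y) →
    Separates G S X Y → Separates H S X Y
  separates-transfer f (X⊈S , Y⊈S , sep) =
    X⊈S , Y⊈S , λ x y x∈X x∉S y∈Y y∉S → f (sep x y x∈X x∉S y∈Y y∉S)

  cutset-transfer : ∀ {S} → (∀ {x y} → ¬ Reach G (∁ S) x y → ¬ Reach H (∁ S) x y) →
    Cutset G S → Cutset H S
  cutset-transfer f cut with cutset⁻ G cut
  ... | _ , _ , x∉S , y∉S , ¬r = cutset⁺ H x∉S y∉S (f ¬r)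

isPart-transfer : ∀ {n} {G H : Graph n} {𝔖 : Family n} {A : Subset n} →
  (∀ {S} → 𝔖 S → ∀ {x y} → (¬ Reach G (∁ S) x y) ⇔ (¬ Reach H (∁ S) x y)) →
  IsPart G 𝔖 A → IsPart H 𝔖 A
isPart-transfer same (unsplit , separated) =
  (λ S s sp → unsplit S s (splits-transfer (Equivalence.from (same s)) sp)) ,
  λ b b∉A → let (S , s , sep) = separated b b∉A in
    S , s , separates-transfer (Equivalence.to (same s)) sep

-- Saturation

module _ {n : ℕ} (G : Graph n) (𝔖 : Family n) where

  reach-saturate : ∀ {W x y} → Reach G W x y → Reach (saturate G 𝔖) W x y
  reach-saturate (here x∈W)     = here x∈W
  reach-saturate (step r a z∈W) = step (reach-saturate r) (inj₁ a) z∈W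

  -- Two vertices of a common member of 𝔖 are equal or adjacent in G^𝔖, so a
  -- walk of G^𝔖 reaching one of them extends to the other.
  reach-across : ∀ {W S x u v} → 𝔖 S → u ∈ S → v ∈ S → v ∈ W →
    Reach (saturate G 𝔖) W x u → Reach (saturate G 𝔖) W x v
  reach-across {u = u} {v} s u∈S v∈S v∈W r with u ≟ v
  ... | yes refl = r
  ... | no u≢v   = step r (inj₂ (u≢v , _ , s , u∈S , v∈S)) v∈W

  -- If S splits no member of 𝔖, then each added edge of G^𝔖 - S joins two
  -- vertices already connected in G - S.  (Connectivity is not decidable
  -- here, hence the double negation.)
  reach-desaturate : ∀ {S} → (∀ {T} → 𝔖 T → ¬ Splits G S T) →
    ∀ {x y} → Reach (saturate G 𝔖) (∁ S) x y → ¬ ¬ Reach G (∁ S) x y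
  reach-desaturate unsplit (here x∉S) ¬r = ¬r (here x∉S)
  reach-desaturate unsplit (step r (inj₁ a) z∉S) ¬r =
    reach-desaturate unsplit r λ r′ → ¬r (step r′ a z∉S)
  reach-desaturate unsplit (step {y = y} {z = z} r (inj₂ (_ , T , τ , y∈T , z∈T)) z∉S) ¬r =
    reach-desaturate unsplit r λ r′ →
      unsplit τ (y , z , y∈T , x∈∁p⇒x∉p (proj₂ (reach-ends _ r)) , z∈T , x∈∁p⇒x∉p z∉S ,
                 λ q → ¬r (reach-trans G r′ q))

  separation-saturate : ∀ {S} → (∀ {T} → 𝔖 T → ¬ Splits G S T) →
    ∀ {x y} → (¬ Reach G (∁ S) x y) ⇔ (¬ Reach (saturate G 𝔖) (∁ S) x y)
  separation-saturate unsplit =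
    mk⇔ (λ ¬r r → reach-desaturate unsplit r ¬r) (λ ¬r r → ¬r (reach-saturate r))

PairwiseIndependent : ∀ {n} → Graph n → Family n → Set
PairwiseIndependent G 𝔖 = ∀ S T → 𝔖 S → 𝔖 T → S ≢ T → Independent G S T

-- In a pairwise independent family no member splits a member (splitting
-- itself is impossible anyway).
no-splits : ∀ {n} {G : Graph n} {𝔖 : Family n} → PairwiseIndependent G 𝔖 →
  ∀ {S T} → 𝔖 S → 𝔖 T → ¬ Splits G S T
no-splits ind {S} {T} s τ sp@(x , _ , x∈T , x∉S , _) =
  proj₁ (ind S T s τ (λ S≡T → x∉S (subst (x ∈_) (≡.sym S≡T) x∈T))) sp

-- Minimum cutsets

module _ {n : ℕ} (G : Graph n) {k : ℕ} (kc : KConnected G k) where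

  -- In a k-connected graph, each vertex t of a k-cutset T has a neighbour in
  -- the component of G - T of every x ∉ T: otherwise T - t would already be a
  -- cutset, separating x from the rest of G - T.
  minimum-cutset-touches : ∀ {T t x} → Cutsetₖ G k T → t ∈ T → x ∉ T →
    ¬ (∀ d → Reach G (∁ T) x d → ¬ Adj G d t)
  minimum-cutset-touches {T} {t} {x} (cut , ∣T∣≡k) t∈T x∉T isolated
    with cutset⁻ G cut
  ... | a , c , a∉T , c∉T , ¬ac =
    reaches-all a∉T λ ra → reaches-all c∉T λ rc → ¬ac (reach-trans G (reach-sym G ra) rc)
    where
    ∉T-t : ∀ {y} → y ∉ T → y ∉ T - t
    ∉T-t y∉T y∈ = y∉T (p─q⊆p T ⁅ t ⁆ y∈)

    -- as t has no neighbour near x, walks from x in G - (T - t) avoid t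
    avoid-t : ∀ {z} → Reach G (∁ (T - t)) x z → Reach G (∁ T) x z
    avoid-t (here _) = here (x∉p⇒x∈∁p x∉T)
    avoid-t (step {y = y} {z = z} r a z∈) with z ≟ t
    ... | yes refl = ⊥-elim (isolated y (avoid-t r) a)
    ... | no z≢t   = step (avoid-t r) a
                       (x∉p⇒x∈∁p λ z∈T → x∈∁p⇒x∉p z∈ (x∈p∧x≢y⇒x∈p-y z∈T z≢t))

    reaches-all : ∀ {y} → y ∉ T → ¬ ¬ Reach G (∁ T) x y
    reaches-all y∉T ¬r =
      ≤⇒≯ (proj₂ kc (T - t) (cutset⁺ G (∉T-t x∉T) (∉T-t y∉T) λ r → ¬r (avoid-t r)))
          (subst (∣ T - t ∣ <_) ∣T∣≡k (x∈p⇒∣p-x∣<∣p∣ t∈T))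

  module Nesting {T T′ B : Subset n} {t b : Fin n} (cT : Cutsetₖ G k T)
    (unsplit : ¬ Splits G T T′) (t∈T : t ∈ T) (t-beyond : Beyond G T′ B t)
    (b∈B : b ∈ B) (b∉T : b ∉ T) where

    -- A walk of G - T from b to a neighbour of t must meet T′ (else b would
    -- reach t in G - T′), and T separates its first vertex in T′ from any
    -- vertex of T′ beyond T; so no such vertex exists.
    beyond-avoids : ∀ {v} → Beyond G T B v → v ∉ T′
    beyond-avoids {v} (v∉T , v-beyond) v∈T′ = minimum-cutset-touches cT t∈T b∉T touch
      where
      touch : ∀ d → Reach G (∁ T) b d → ¬ Adj G d t
      touch d p a with first-hit G {X = T′} p
      ... | inj₁ p′ =
        proj₂ t-beyond b b∈B (x∈∁p⇒x∉p (proj₁ (reach-ends G p′)))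
          (reach-sym G (step p′ a (x∉p⇒x∈∁p (proj₁ t-beyond))))
      ... | inj₂ (w , w∈T′ , q) =
        unsplit (v , w , v∈T′ , v∉T , w∈T′ , x∈∁p⇒x∉p (proj₂ (reach-ends G q)) ,
                 λ s → v-beyond b b∈B b∉T (reach-trans G s (reach-sym G q)))

    beyond-walk : ∀ {v z} → Beyond G T B v → Reach G (∁ T) v z → Reach G (∁ T′) v z
    beyond-walk v-beyond (here _) = here (x∉p⇒x∈∁p (beyond-avoids v-beyond))
    beyond-walk v-beyond (step r a z∉T) =
      step (beyond-walk v-beyond r) a
           (x∉p⇒x∈∁p (beyond-avoids (beyond-closed G v-beyond (step r a z∉T))))

    -- v beyond T reaches t in G - T′ through a neighbour of t, so whatever v
    -- reaches in G - T′ is reached by t, which lies beyond T′.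
    beyond-nested : ∀ {v} → Beyond G T B v → Beyond G T′ B v
    beyond-nested v-beyond = beyond-avoids v-beyond , λ c c∈B c∉T′ r →
      minimum-cutset-touches cT t∈T (proj₁ v-beyond) λ d p a →
        proj₂ t-beyond c c∈B c∉T′
          (reach-trans G (reach-sym G (step (beyond-walk v-beyond p) a
                                              (x∉p⇒x∈∁p (proj₁ t-beyond)))) r)

-- Part (2): parts of a subfamily 𝔗 ⊆ 𝔖 in the saturated graph

module PartCutsets {n : ℕ} (G : Graph n) (𝔖 𝔗 : Family n) (ind : PairwiseIndependent G 𝔖)
  (𝔗⊆𝔖 : ∀ S → 𝔗 S → 𝔖 S) (B : Subset n) (part : IsPart G 𝔗 B) where

  module _ (R : Subset n) (x : Fin n) where

    -- Where a walk of G - R from x ∈ B ─ R may be: at a vertex of B that x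
    -- reaches in G^𝔖(B ─ R), or beyond some T ∈ 𝔗 having a vertex u that x
    -- reaches in G^𝔖(B ─ R).
    data Trace (z : Fin n) : Set where
      home : z ∈ B → Reach (saturate G 𝔖) (B ─ R) x z → Trace z
      away : ∀ {u T} → Reach (saturate G 𝔖) (B ─ R) x u → 𝔗 T → u ∈ T →
             Beyond G T B z → Trace z

    -- Leaving B, the walk goes beyond the member of 𝔗 that separates the new
    -- vertex from B, which must contain the vertex it left.
    trace-home : ∀ {z z′} → z ∈ B → Reach (saturate G 𝔖) (B ─ R) x z →
      Adj G z z′ → z′ ∉ R → Trace z′
    trace-home {z} {z′} z∈B r a z′∉R with z′ ∈? B
    ... | yes z′∈B = home z′∈B (step r (inj₁ a) (x∈p∧x∉q⇒x∈p─q z′∈B z′∉R))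
    ... | no z′∉B with part-exterior G part z′∉B
    ...   | T , τ , _ , z′∉T , z′-beyond with z ∈? T
    ...     | yes z∈T = away r τ z∈T (z′∉T , z′-beyond)
    ...     | no z∉T  = ⊥-elim (z′-beyond z z∈B z∉T
                          (edge G (x∉p⇒x∈∁p z′∉T) (sym G a) (x∉p⇒x∈∁p z∉T)))

    -- Beyond T, the walk stays beyond T until it enters T; there it is back in
    -- B (joined to u by a saturated edge), or beyond another T′ ∈ 𝔗, which
    -- must contain u since T′ does not split T.
    trace-away : ∀ {z z′ u T} → Reach (saturate G 𝔖) (B ─ R) x u → 𝔗 T → u ∈ T →
      Beyond G T B z → Adj G z z′ → z′ ∉ R → Trace z′
    trace-away {z′ = z′} {u} {T} r τ u∈T z-beyond a z′∉R with z′ ∈? T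
    ... | no z′∉T = away r τ u∈T
                      (beyond-closed G z-beyond (edge G (x∉p⇒x∈∁p (proj₁ z-beyond)) a (x∉p⇒x∈∁p z′∉T)))
    ... | yes z′∈T with z′ ∈? B
    ...   | yes z′∈B = home z′∈B
                         (reach-across G 𝔖 (𝔗⊆𝔖 T τ) u∈T z′∈T (x∈p∧x∉q⇒x∈p─q z′∈B z′∉R) r)
    ...   | no z′∉B with part-exterior G part z′∉B
    ...     | T′ , τ′ , _ , z′∉T′ , z′-beyond with u ∈? T′
    ...       | yes u∈T′ = away r τ′ u∈T′ (z′∉T′ , z′-beyond)
    ...       | no u∉T′  = ⊥-elim (no-splits ind (𝔗⊆𝔖 T′ τ′) (𝔗⊆𝔖 T τ)
                             (z′ , u , z′∈T , z′∉T′ , u∈T , u∉T′ , z′-beyond u u∈B u∉T′))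
      where
      u∈B : u ∈ B
      u∈B = p─q⊆p B R (proj₂ (reach-ends _ r))

    trace : ∀ {z} → x ∈ B ─ R → Reach G (∁ R) x z → Trace z
    trace x∈ (here _) = home (p─q⊆p B R x∈) (here x∈)
    trace x∈ (step r a z′∉R) with trace x∈ r
    ... | home z∈B r′            = trace-home z∈B r′ a (x∈∁p⇒x∉p z′∉R)
    ... | away r′ τ u∈T z-beyond = trace-away r′ τ u∈T z-beyond a (x∈∁p⇒x∉p z′∉R)

  part-cutset : ∀ R → CutsetIn (saturate G 𝔖) B R → Cutset G R
  part-cutset R (_ , x , y , x∈ , y∈ , ¬r) =
    cutset⁺ G (x∈p─q⇒x∉q B R x∈) (x∈p─q⇒x∉q B R y∈) λ p → ends-home (trace R x x∈ p)
    where
    ends-home : Trace R x y → ⊥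
    ends-home (home _ r)            = ¬r r
    ends-home (away _ _ _ y-beyond) = beyond⇒∉ G y-beyond (p─q⊆p B R y∈)

module PartSize {n : ℕ} (G : Graph n) (k : ℕ) (𝔖 𝔗 : Family n) (kc : KConnected G k)
  (ck : ∀ S → 𝔖 S → Cutsetₖ G k S) (ind : PairwiseIndependent G 𝔖)
  (𝔗⊆𝔖 : ∀ S → 𝔗 S → 𝔖 S) (B : Subset n) (part : IsPart G 𝔗 B) where

  Outer : Subset n → Set
  Outer L = ∃ λ T → 𝔗 T × B ⊈ T × (∀ {v} → v ∈ L → Beyond G T B v)

  module _ (∣B∣≤k : ∣ B ∣ ≤ k) where

    -- Pick b ∈ B ∖ T, then t ∈ T ∖ B (as ∣B∣ ≤ ∣T∣) and T′ ∈ 𝔗 with t beyond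
    -- T′; by nesting, L ∪ {t} lies beyond T′, and t ∉ L as t ∈ T.
    grow : ∀ {L} → Outer L → ∃ λ L′ → L ⊂ L′ × Outer L′
    grow {L} (T , τ , B⊈T , L-beyond) with ⊈⇒witness B⊈T
    ... | b , b∈B , b∉T
      with ⊈-of-smaller (subst (∣ B ∣ ≤_) (≡.sym (proj₂ (ck T (𝔗⊆𝔖 T τ)))) ∣B∣≤k) B⊈T
    ... | t , t∈T , t∉B with part-exterior G part t∉B
    ... | T′ , τ′ , B⊈T′ , t-beyond =
      L ∪ ⁅ t ⁆ ,
      (p⊆p∪q ⁅ t ⁆ , t , x∈p∪q⁺ (inj₂ (x∈⁅x⁆ t)) , λ t∈L → proj₁ (L-beyond t∈L) t∈T) ,
      T′ , τ′ , B⊈T′ , L∪t-beyond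
      where
      open Nesting G kc (ck T (𝔗⊆𝔖 T τ)) (no-splits ind (𝔗⊆𝔖 T τ) (𝔗⊆𝔖 T′ τ′))
                   t∈T t-beyond b∈B b∉T
      L∪t-beyond : ∀ {v} → v ∈ L ∪ ⁅ t ⁆ → Beyond G T′ B v
      L∪t-beyond v∈ with x∈p∪q⁻ L ⁅ t ⁆ v∈
      ... | inj₁ v∈L   = beyond-nested (L-beyond v∈L)
      ... | inj₂ v∈⁅t⁆ = subst (Beyond G T′ B) (≡.sym (x∈⁅y⁆⇒x≡y t v∈⁅t⁆)) t-beyond

    ⊤⊈B : ⊤ ⊈ B
    ⊤⊈B ⊤⊆B = ≤⇒≯ ∣B∣≤k (<-≤-trans (proj₁ kc) (p⊆q⇒∣p∣≤∣q∣ ⊤⊆B))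

    -- Some vertex lies outside B since ∣B∣ ≤ k < n; the member of 𝔗
    -- separating it from B starts an endless growth from ∅.
    no-small-part : ⊥
    no-small-part with ⊈⇒witness ⊤⊈B
    ... | _ , _ , b∉B with part-exterior G part b∉B
    ... | T , τ , B⊈T , _ =
      no-endless-growth Outer grow ∅ (T , τ , B⊈T , λ v∈∅ → ⊥-elim (∉⊥ v∈∅))

  part-large : k < ∣ B ∣
  part-large = ≰⇒> no-small-part

lemma3 : ∀ {n : ℕ} (G : Graph n) (k : ℕ) (𝔖 : Family n) →
    KConnected G k →
    (∀ S → 𝔖 S → Cutsetₖ G k S) →
    (∀ S T → 𝔖 S → 𝔖 T → S ≢ T → Independent G S T) →
    ((∀ S → 𝔖 S → Cutsetₖ (saturate G 𝔖) k S)
     × (∀ A → IsPart G 𝔖 A ⇔ IsPart (saturate G 𝔖) 𝔖 A))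
    × (∀ (𝔗 : Family n) → (∀ S → 𝔗 S → 𝔖 S) →
         ∀ (B : Subset n) → IsPart G 𝔗 B →
         (∀ (R : Subset n) → CutsetIn (saturate G 𝔖) B R → Cutset G R)
         × KConnectedIn (saturate G 𝔖) k B)
lemma3 G k 𝔖 kc ck ind =
  ( (λ S s → cutset-transfer (Equivalence.to (same s)) (proj₁ (ck S s)) , proj₂ (ck S s))
  , λ A → mk⇔ (isPart-transfer same) (isPart-transfer (λ s → ⇔.sym (same s))) )
  , λ 𝔗 𝔗⊆𝔖 B part →
      let cutsets = PartCutsets.part-cutset G 𝔖 𝔗 ind 𝔗⊆𝔖 B part in
      cutsets ,
      PartSize.part-large G k 𝔖 𝔗 kc ck ind 𝔗⊆𝔖 B part ,
      λ R cut → proj₂ kc R (cutsets R cut)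
  where
  same : ∀ {S} → 𝔖 S → ∀ {x y} → (¬ Reach G (∁ S) x y) ⇔ (¬ Reach (saturate G 𝔖) (∁ S) x y)
  same s = separation-saturate G 𝔖 (no-splits ind s)
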